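{- If $G$ is a finite connected graph, then $c(G) \leq \operatorname{th}_d(G)$.
   Context: Cops and Robbers on a finite simple graph $G$: in round $0$ each of $k$ cops and then the robber choose a vertex; in each later round each cop stays or moves along an edge, then the robber does the same. The robber is captured if a cop occupies the robber's vertex. $c(G)$ (the cop number) is the minimum number of cops that can guarantee capture. A vertex is damaged if the robber occupies it in a round in which capture does not occur (i.e., the robber is on it and is not captured by the cops' next move). For $1\le k\le n=|V(G)|$, the $k$-damage number $\operatorname{dmg}_k(G)$ is the minimum number of vertices damaged over all games with $k$ cops where the robber places and plays to maximize damage (cops play to minimize it, not necessarily capturing). The damage throttling number is $\operatorname{th}_d(G)=\min_{1\le k\le n}\{k+\operatorname{dmg}_k(G)\}$. -}

module Defs where

open import Data.Nat using (ℕ; zero; suc; _+_; _≤_; _<_)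
open import Data.Fin using (Fin)
open import Data.Bool using (Bool; true; false)
open import Data.List using (List; []; _∷_; length)
open import Data.List.Relation.Unary.All using (All)
open import Data.List.Relation.Unary.Unique.Propositional using (Unique)
open import Data.Product using (Σ; ∃; _×_; _,_; proj₁; proj₂)
open import Data.Sum using (_⊎_)
open import Relation.Nullary using (¬_)
open import Relation.Binary.PropositionalEquality using (_≡_; _≢_)

record SimpleGraph (n : ℕ) : Set where
  field
    adj    : Fin n → Fin n → Bool
    irrefl : ∀ u → adj u u ≡ false
    sym    : ∀ u v → adj u v ≡ adj v u
open SimpleGraph public

data Reachable {n : ℕ} (G : SimpleGraph n) : Fin n → Fin n → Set where
  here : ∀ {u} → Reachable G u u
  step : ∀ {u v w} → adj G u v ≡ true → Reachable G v w → Reachable G u w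

Connected : {n : ℕ} → SimpleGraph n → Set
Connected G = ∀ u v → Reachable G u v

Move : {n : ℕ} → SimpleGraph n → Fin n → Fin n → Set
Move G u v = (u ≡ v) ⊎ (adj G u v ≡ true)

Cops : ℕ → ℕ → Set
Cops k n = Fin k → Fin n

Pos : ℕ → ℕ → Set
Pos k n = Cops k n × Fin n

-- Strategies may depend on the whole history.  A history is given by the
-- list of earlier configurations (most recent first) and the current one.
record CopStrategy {n : ℕ} (G : SimpleGraph n) (k : ℕ) : Set where
  field
    start : Cops k n
    move  : List (Pos k n) → Pos k n → Cops k n
    legal : ∀ past cur i → Move G (proj₁ cur i) (move past cur i)

record RobberStrategy {n : ℕ} (G : SimpleGraph n) (k : ℕ) : Set where
  field
    start : Cops k n → Fin n
    -- the robber moves after seeing the cops' new positions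
    move  : List (Pos k n) → Pos k n → Cops k n → Fin n
    legal : ∀ past cur c → Move G (proj₂ cur) (move past cur c)

module _ {n : ℕ} {G : SimpleGraph n} {k : ℕ}
         (cs : CopStrategy G k) (rs : RobberStrategy G k) where
  private
    module C = CopStrategy cs
    module R = RobberStrategy rs

  history : ℕ → List (Pos k n) × Pos k n
  history zero = [] , (C.start , R.start C.start)
  history (suc t) with history t
  ... | past , cur =
    let c′ = C.move past cur in
    (cur ∷ past) , (c′ , R.move past cur c′)

  copsAt : ℕ → Cops k n
  copsAt t = proj₁ (proj₂ (history t))

  robberAt : ℕ → Fin n
  robberAt t = proj₂ (proj₂ (history t))

  -- capture occurs in round t (either when the cops move onto the robber,
  -- or when the robber moves onto a cop; in round 0 when placed together)
  CaughtIn : ℕ → Set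
  CaughtIn zero    = ∃ λ i → copsAt zero i ≡ robberAt zero
  CaughtIn (suc t) = (∃ λ i → copsAt (suc t) i ≡ robberAt t)
                   ⊎ (∃ λ i → copsAt (suc t) i ≡ robberAt (suc t))

  Damaged : Fin n → Set
  Damaged v = ∃ λ t → robberAt t ≡ v
                    × (∀ s → s ≤ t → ¬ CaughtIn s)
                    × (∀ i → copsAt (suc t) i ≢ robberAt t)

CopsWin : {n : ℕ} → SimpleGraph n → ℕ → Set
CopsWin G k = Σ (CopStrategy G k) λ cs →
  ∀ (rs : RobberStrategy G k) → ∃ λ t → CaughtIn cs rs t

IsCopNumber : {n : ℕ} → SimpleGraph n → ℕ → Set
IsCopNumber G c = CopsWin G c × (∀ j → j < c → ¬ CopsWin G j)

DmgAtMost : {n : ℕ} → SimpleGraph n → ℕ → ℕ → Set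
DmgAtMost G k d = Σ (CopStrategy G k) λ cs →
  ∀ (rs : RobberStrategy G k) (vs : List (Fin _)) →
    Unique vs → All (Damaged cs rs) vs → length vs ≤ d

IsDmg : {n : ℕ} → SimpleGraph n → ℕ → ℕ → Set
IsDmg G k d = DmgAtMost G k d × (∀ d′ → d′ < d → ¬ DmgAtMost G k d′)

IsDmgThrottle : {n : ℕ} → SimpleGraph n → ℕ → Set
IsDmgThrottle {n} G t =
  (∃ λ k → ∃ λ d → 1 ≤ k × k ≤ n × IsDmg G k d × t ≡ k + d)
  × (∀ k d → 1 ≤ k → k ≤ n → IsDmg G k d → t ≤ k + d)

-- Let k cops follow a strategy S keeping the damage at most d, and add d guards.
-- The guards walk to the robber's initial vertex along a walk of length L and then
-- replay his trail L + 1 rounds late, guard j parking for good on the j-th distinct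
-- vertex of that delayed trail.  If the robber is never caught, every vertex he
-- visits is damaged in the game against S alone, so he visits at most d vertices
-- and all of them end up guarded.  Hence in every L + 1 rounds he must step onto a
-- vertex he had not visited before, which is impossible for (d + 1)(L + 1) rounds.
-- So k + dmg_k(G) cops capture the robber, for every k.

module Submission where

open import Defs hiding (sym)
open import Data.Fin using (Fin; toℕ; fromℕ<; _↑ˡ_; _↑ʳ_)
import Data.Fin as Fin
import Data.Bool as Bool
import Data.Vec.Functional as Vector
open import Data.Bool using (true)
open import Data.Fin.Properties using (any?; toℕ-fromℕ<)
open import Data.Nat using (ℕ; zero; suc; _+_; _*_; _∸_; _≤_; _<_; _≮_; z≤n; s≤s; s≤s⁻¹; _≤?_; _<?_)
open import Data.Nat.Properties
open import Data.List using (List; []; _∷_; _++_; length; map; take; drop; head; last)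
open import Data.List.Properties using (drop-[]; drop-all; take++drop≡id)
open import Data.List.Membership.Propositional using (_∈_; _∉_)
open import Data.List.Membership.Propositional.Properties using (∈-++⁻)
open import Data.List.Relation.Unary.Any using (here; there)
open import Data.List.Relation.Unary.All using (All) renaming (tabulate to tabulateAll)
open import Data.List.Relation.Unary.All.Properties using (¬Any⇒All¬)
open import Data.List.Relation.Unary.Unique.Propositional using (Unique)
open import Data.List.Relation.Unary.AllPairs using ([]; _∷_)
open import Data.Vec.Functional.Properties using (lookup-++ˡ; lookup-++ʳ)
open import Data.Vec.Functional.Relation.Binary.Pointwise using (Pointwise)
open import Data.Vec.Functional.Relation.Binary.Pointwise.Properties using (++⁺)
open import Data.Maybe using (just; fromMaybe)
open import Data.Product using (∃; _×_; _,_; proj₁; proj₂)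
open import Data.Sum using (_⊎_; inj₁; inj₂; [_,_]′)
open import Function using (_∘_; id; flip)
open import Relation.Nullary using (¬_; Dec; yes; no; contradiction)
open import Relation.Nullary.Decidable using (_⊎-dec_)
open import Relation.Binary.Core using (Rel)
open import Relation.Binary.Definitions using (DecidableEquality; Reflexive)
open import Relation.Binary.PropositionalEquality
  using (_≡_; refl; sym; trans; cong; cong₂; subst; module ≡-Reasoning)

module Distinct {a} {A : Set a} (_≟_ : DecidableEquality A) where
  open import Data.List.Membership.DecPropositional _≟_ using (_∈?_)

  distinct : List A → List A
  distinct []       = []
  distinct (x ∷ xs) with x ∈? xs
  ... | yes _ = distinct xs
  ... | no  _ = x ∷ distinct xs

  #distinct : List A → ℕ
  #distinct xs = length (distinct xs)

  ∈-distinct⁻ : ∀ {y} xs → y ∈ distinct xs → y ∈ xs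
  ∈-distinct⁻ (x ∷ xs) y∈ with x ∈? xs
  ... | yes _ = there (∈-distinct⁻ xs y∈)
  ∈-distinct⁻ (x ∷ xs) (here y≡x)  | no _ = here y≡x
  ∈-distinct⁻ (x ∷ xs) (there y∈) | no _ = there (∈-distinct⁻ xs y∈)

  distinct-unique : ∀ xs → Unique (distinct xs)
  distinct-unique []       = []
  distinct-unique (x ∷ xs) with x ∈? xs
  ... | yes _  = distinct-unique xs
  ... | no x∉ = ¬Any⇒All¬ _ (x∉ ∘ ∈-distinct⁻ xs) ∷ distinct-unique xs

  #distinct-∷-∉ : ∀ {x} xs → x ∉ xs → #distinct (x ∷ xs) ≡ suc (#distinct xs)
  #distinct-∷-∉ {x} xs x∉ with x ∈? xs
  ... | yes x∈ = contradiction x∈ x∉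
  ... | no  _  = refl

  #distinct-∷ : ∀ x xs → #distinct xs ≤ #distinct (x ∷ xs)
  #distinct-∷ x xs with x ∈? xs
  ... | yes _ = ≤-refl
  ... | no  _ = n≤1+n _

  #distinct-++ : ∀ xs ys → #distinct ys ≤ #distinct (xs ++ ys)
  #distinct-++ []       ys = ≤-refl
  #distinct-++ (x ∷ xs) ys = ≤-trans (#distinct-++ xs ys) (#distinct-∷ x (xs ++ ys))

  #distinct-++-< : ∀ {x} xs ys → x ∈ xs → x ∉ ys → #distinct ys < #distinct (xs ++ ys)
  #distinct-++-< (y ∷ xs) ys (there x∈xs) x∉ys =
    <-≤-trans (#distinct-++-< xs ys x∈xs x∉ys) (#distinct-∷ y (xs ++ ys))
  #distinct-++-< (x ∷ xs) ys (here refl) x∉ys with x ∈? xs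
  ... | yes x∈xs = <-≤-trans (#distinct-++-< xs ys x∈xs x∉ys) (#distinct-∷ x (xs ++ ys))
  ... | no  x∉xs = begin-strict
    #distinct ys                ≤⟨ #distinct-++ xs ys ⟩
    #distinct (xs ++ ys)        <⟨ n<1+n _ ⟩
    suc (#distinct (xs ++ ys))  ≡⟨ #distinct-∷-∉ (xs ++ ys) x∉xs++ys ⟨
    #distinct (x ∷ xs ++ ys)    ∎
    where
      open ≤-Reasoning
      x∉xs++ys : x ∉ xs ++ ys
      x∉xs++ys x∈xs++ys with ∈-++⁻ xs x∈xs++ys
      ... | inj₁ x∈xs = x∉xs x∈xs
      ... | inj₂ x∈ys = x∉ys x∈ys

-- With the trail xs listed most recent first, guard j stands on the j-th distinct
-- vertex of xs in order of first visit, and on the newest vertex of xs (z if xs is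
-- empty) while xs has at most j distinct vertices.
module Guard {a} {A : Set a} (_≟_ : DecidableEquality A) where
  open import Data.List.Membership.DecPropositional _≟_ using (_∈?_)
  open Distinct _≟_

  guard : List A → A → ℕ → A
  guard []       z j = z
  guard (x ∷ xs) z j with j <? #distinct xs
  ... | yes _ = guard xs z j
  ... | no  _ = x

  guard-∷-< : ∀ {x} xs z {j} → j < #distinct xs → guard (x ∷ xs) z j ≡ guard xs z j
  guard-∷-< xs z {j} j< with j <? #distinct xs
  ... | yes _  = refl
  ... | no j≮ = contradiction j< j≮

  guard-∷-≮ : ∀ {x} xs z {j} → j ≮ #distinct xs → guard (x ∷ xs) z j ≡ x
  guard-∷-≮ xs z {j} j≮ with j <? #distinct xs
  ... | yes j< = contradiction j< j≮
  ... | no  _  = refl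

  guard-≥ : ∀ xs z {j} → #distinct xs ≤ j → guard xs z j ≡ fromMaybe z (head xs)
  guard-≥ []       z _  = refl
  guard-≥ (x ∷ xs) z ≥j = guard-∷-≮ xs z (≤⇒≯ (≤-trans (#distinct-∷ x xs) ≥j))

  guard-move : ∀ {r} {R : Rel A r} → Reflexive R → ∀ {x} xs z j →
               R (fromMaybe z (head xs)) x → R (guard xs z j) (guard (x ∷ xs) z j)
  guard-move {R = R} R-refl {x} xs z j head-to-x with j <? #distinct xs
  ... | yes _  = R-refl
  ... | no j≮ = subst (λ y → R y x) (sym (guard-≥ xs z (≮⇒≥ j≮))) head-to-x

  guard-covers : ∀ {y} xs z → y ∈ xs → ∃ λ j → j < #distinct xs × guard xs z j ≡ y
  guard-covers (x ∷ xs) z (there y∈xs) with guard-covers xs z y∈xs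
  ... | j , j< , guard≡y = j , <-≤-trans j< (#distinct-∷ x xs) , trans (guard-∷-< xs z j<) guard≡y
  guard-covers (x ∷ xs) z (here refl) with x ∈? xs
  ... | yes x∈xs with guard-covers xs z x∈xs
  ...   | j , j< , guard≡x = j , j< , trans (guard-∷-< xs z j<) guard≡x
  guard-covers (x ∷ xs) z (here refl) | no _ =
    #distinct xs , ≤-refl , guard-∷-≮ xs z (n≮n _)

module Walk {n} (G : SimpleGraph n) where

  walkAt : ∀ {u v} → Reachable G u v → ℕ → Fin n
  walkAt {u} _          zero    = u
  walkAt {u} here       (suc _) = u
  walkAt     (step _ w) (suc i) = walkAt w i

  walkLength : ∀ {u v} → Reachable G u v → ℕ
  walkLength here       = 0
  walkLength (step _ w) = suc (walkLength w)

  walkAt-move : ∀ {u v} (w : Reachable G u v) i → Move G (walkAt w i) (walkAt w (suc i))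
  walkAt-move here         zero    = inj₁ refl
  walkAt-move here         (suc _) = inj₁ refl
  walkAt-move (step u~v _) zero    = inj₂ u~v
  walkAt-move (step _ w)   (suc i) = walkAt-move w i

  walkAt-≥ : ∀ {u v} (w : Reachable G u v) {i} → walkLength w ≤ i → walkAt w i ≡ v
  walkAt-≥ here       {zero}  _          = refl
  walkAt-≥ here       {suc _} _          = refl
  walkAt-≥ (step _ w) {suc _} (s≤s len≤) = walkAt-≥ w len≤

module Game {n} {G : SimpleGraph n} {m} (cs : CopStrategy G m) where
  private module C = CopStrategy cs

  -- Robber positions are listed most recent first, as in history.
  mutual
    replayCops : List (Fin n) → Cops m n
    replayCops []       = C.start
    replayCops (r ∷ rl) = C.move (replayPast rl) (replayCops rl , r)

    replayPast : List (Fin n) → List (Pos m n)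
    replayPast []       = []
    replayPast (r ∷ rl) = (replayCops rl , r) ∷ replayPast rl

  replayCops-move : ∀ r rl → Pointwise (Move G) (replayCops rl) (replayCops (r ∷ rl))
  replayCops-move r rl = C.legal (replayPast rl) (replayCops rl , r)

  module _ (rs : RobberStrategy G m) where
    private module R = RobberStrategy rs

    trail : ℕ → List (Fin n)
    trail t = map proj₂ (proj₁ (history cs rs t))

    length-trail : ∀ t → length (trail t) ≡ t
    length-trail zero    = refl
    length-trail (suc t) = cong suc (length-trail t)

    drop-trail : ∀ {d t} → d ≤ t → drop d (trail t) ≡ trail (t ∸ d)
    drop-trail {t = t}     z≤n       = refl
    drop-trail {t = suc t} (s≤s d≤t) = drop-trail d≤t

    last-trail : ∀ t → last (trail (suc t)) ≡ just (robberAt cs rs 0)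
    last-trail zero    = refl
    last-trail (suc t) = last-trail t

    ∈-trail : ∀ {v} t → v ∈ trail t → ∃ λ s → s < t × robberAt cs rs s ≡ v
    ∈-trail (suc t) (here v≡r)  = t , ≤-refl , sym v≡r
    ∈-trail (suc t) (there v∈) with ∈-trail t v∈
    ... | s , s<t , eq = s , m≤n⇒m≤1+n s<t , eq

    mutual
      past-replay : ∀ t → proj₁ (history cs rs t) ≡ replayPast (trail t)
      past-replay zero    = refl
      past-replay (suc t) =
        cong₂ _∷_ (cong (_, robberAt cs rs t) (copsAt-replay t)) (past-replay t)

      copsAt-replay : ∀ t → copsAt cs rs t ≡ replayCops (trail t)
      copsAt-replay zero    = refl
      copsAt-replay (suc t) =
        cong₂ (λ past cops → C.move past (cops , robberAt cs rs t)) (past-replay t) (copsAt-replay t)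

    robberReply : List (Fin n) → Fin n → Fin n
    robberReply rl r = R.move (replayPast rl) (replayCops rl , r) (replayCops (r ∷ rl))

    robberAt-suc : ∀ t → robberAt cs rs (suc t) ≡ robberReply (trail t) (robberAt cs rs t)
    robberAt-suc t =
      cong₂ (λ past cops → R.move past (cops , r) (C.move past (cops , r))) (past-replay t) (copsAt-replay t)
      where r = robberAt cs rs t

    robberAt-move : ∀ t → Move G (robberAt cs rs t) (robberAt cs rs (suc t))
    robberAt-move t = R.legal _ _ _

    caughtIn? : ∀ t → Dec (CaughtIn cs rs t)
    caughtIn? zero    = any? λ i → copsAt cs rs 0 i Fin.≟ robberAt cs rs 0
    caughtIn? (suc t) = any? (λ i → copsAt cs rs (suc t) i Fin.≟ robberAt cs rs t)
                 ⊎-dec any? (λ i → copsAt cs rs (suc t) i Fin.≟ robberAt cs rs (suc t))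

    caughtIn-onRobber : ∀ t i → copsAt cs rs t i ≡ robberAt cs rs t → CaughtIn cs rs t
    caughtIn-onRobber zero    i eq = i , eq
    caughtIn-onRobber (suc t) i eq = inj₂ (i , eq)

    EvadesUntil : ℕ → Set
    EvadesUntil T = ∀ s → s ≤ T → ¬ CaughtIn cs rs s

    evadesUntil-mono : ∀ {T′ T} → T′ ≤ T → EvadesUntil T → EvadesUntil T′
    evadesUntil-mono T′≤T evades s s≤T′ = evades s (≤-trans s≤T′ T′≤T)

    capture-or-evasion : ∀ T → (∃ λ t → CaughtIn cs rs t) ⊎ EvadesUntil T
    capture-or-evasion T with any? {n = suc T} (caughtIn? ∘ toℕ)
    ... | yes (i , caught) = inj₁ (toℕ i , caught)
    ... | no  never        = inj₂ λ s s≤T caught →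
      never (fromℕ< (s≤s s≤T) , subst (CaughtIn cs rs) (sym (toℕ-fromℕ< (s≤s s≤T))) caught)

module Replay {n} {G : SimpleGraph n} {m} (cs : CopStrategy G m) (rs : RobberStrategy G m) where
  private module Big = Game cs

  -- Plays rs against cs, ignoring the cops it actually faces.
  replayRobber : ∀ {k} → RobberStrategy G k
  replayRobber = record
    { start = λ _ → RobberStrategy.start rs (CopStrategy.start cs)
    ; move  = λ past cur _ → Big.robberReply rs (map proj₂ past) (proj₂ cur)
    ; legal = λ past cur _ → RobberStrategy.legal rs _ _ _
    }

  module _ {k} (S : CopStrategy G k) where
    private module Small = Game S

    mutual
      robberAt-replayRobber : ∀ t → robberAt S replayRobber t ≡ robberAt cs rs t
      robberAt-replayRobber zero    = refl
      robberAt-replayRobber (suc t) =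
        trans (cong₂ (Big.robberReply rs) (trail-replayRobber t) (robberAt-replayRobber t))
              (sym (Big.robberAt-suc rs t))

      trail-replayRobber : ∀ t → Small.trail replayRobber t ≡ Big.trail rs t
      trail-replayRobber zero    = refl
      trail-replayRobber (suc t) = cong₂ _∷_ (robberAt-replayRobber t) (trail-replayRobber t)

    copsAt-replayRobber : ∀ t → copsAt S replayRobber t ≡ Small.replayCops (Big.trail rs t)
    copsAt-replayRobber t =
      trans (Small.copsAt-replay replayRobber t) (cong Small.replayCops (trail-replayRobber t))

module _ {n} {G : SimpleGraph n} {m k}
         {cs : CopStrategy G m} {rs : RobberStrategy G m} {S : CopStrategy G k} {rs′ : RobberStrategy G k}
         (ι : Fin k → Fin m)
         (same-cops : ∀ t i → copsAt S rs′ t i ≡ copsAt cs rs t (ι i))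
         (same-robber : ∀ t → robberAt S rs′ t ≡ robberAt cs rs t) where

  private
    relabel : ∀ t t′ i → copsAt S rs′ t i ≡ robberAt S rs′ t′ → copsAt cs rs t (ι i) ≡ robberAt cs rs t′
    relabel t t′ i eq = trans (sym (same-cops t i)) (trans eq (same-robber t′))

  CaughtIn-subteam : ∀ t → CaughtIn S rs′ t → CaughtIn cs rs t
  CaughtIn-subteam zero    (i , eq)        = ι i , relabel 0 0 i eq
  CaughtIn-subteam (suc t) (inj₁ (i , eq)) = inj₁ (ι i , relabel (suc t) t i eq)
  CaughtIn-subteam (suc t) (inj₂ (i , eq)) = inj₂ (ι i , relabel (suc t) (suc t) i eq)

module Planned {n} (G : SimpleGraph n) {m} (plan : List (Fin n) → Cops m n) where

  move? : ∀ u v → Dec (Move G u v)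
  move? u v = u Fin.≟ v ⊎-dec adj G u v Bool.≟ true

  -- Needed only for the legality field: along actual play the plan moves legally.
  tryMove : Fin n → Fin n → Fin n
  tryMove u v with move? u v
  ... | yes _ = v
  ... | no  _ = u

  tryMove-move : ∀ u v → Move G u (tryMove u v)
  tryMove-move u v with move? u v
  ... | yes u→v = u→v
  ... | no  _   = inj₁ refl

  tryMove-legal : ∀ {u v} → Move G u v → tryMove u v ≡ v
  tryMove-legal {u} {v} u→v with move? u v
  ... | yes _    = refl
  ... | no  u↛v = contradiction u→v u↛v

  planned : CopStrategy G m
  planned = record
    { start = plan []
    ; move  = λ past cur i → tryMove (proj₁ cur i) (plan (proj₂ cur ∷ map proj₂ past) i)
    ; legal = λ _ cur i → tryMove-move (proj₁ cur i) _
    }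

  open Game planned using (trail)

  copsAt-planned : ∀ rs → (∀ t → Pointwise (Move G) (plan (trail rs t)) (plan (trail rs (suc t)))) →
                   ∀ t i → copsAt planned rs t i ≡ plan (trail rs t) i
  copsAt-planned rs plan-move zero    i = refl
  copsAt-planned rs plan-move (suc t) i =
    trans (cong (λ u → tryMove u (plan (trail rs (suc t)) i)) (copsAt-planned rs plan-move t i))
          (tryMove-legal (plan-move t i))

module Guarded {n} (G : SimpleGraph n) (conn : Connected G) (x₀ : Fin n) {k d} (S : CopStrategy G k)
               (damage≤d : ∀ rs vs → Unique vs → All (Damaged S rs) vs → length vs ≤ d) where
  open Distinct (Fin._≟_ {n})
  open Guard (Fin._≟_ {n})
  open Walk G

  -- The guards walk from x₀ to the robber's initial vertex along w and then follow
  -- his trail with its walkLength w most recent entries dropped.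
  guards : List (Fin n) → Fin d → Fin n
  guards rl j = guard (drop (walkLength w) rl) (walkAt w (length rl)) (toℕ j)
    where
      w : Reachable G x₀ (fromMaybe x₀ (last rl))
      w = conn x₀ (fromMaybe x₀ (last rl))

  plan : List (Fin n) → Cops (k + d) n
  plan rl = Game.replayCops S rl Vector.++ guards rl

  open Planned G plan using (planned; copsAt-planned)

  module _ (rs : RobberStrategy G (k + d)) where
    open Game planned
    open Replay planned rs

    robber : ℕ → Fin n
    robber = robberAt planned rs

    visited : ℕ → List (Fin n)
    visited = trail rs

    w₀ : Reachable G x₀ (robber 0)
    w₀ = conn x₀ (robber 0)

    L : ℕ
    L = walkLength w₀

    guards-visited : ∀ t j → guards (visited t) j ≡ guard (drop L (visited t)) (walkAt w₀ t) (toℕ j)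
    guards-visited zero    j
      rewrite drop-[] {A = Fin n} L | drop-[] {A = Fin n} (walkLength (conn x₀ x₀)) = refl
    guards-visited (suc t) j rewrite last-trail rs t | length-trail rs (suc t) = refl

    guards-late : ∀ {t} → L ≤ t → ∀ j → guards (visited t) j ≡ guard (visited (t ∸ L)) (robber 0) (toℕ j)
    guards-late {t} L≤t j rewrite guards-visited t j | drop-trail rs L≤t | walkAt-≥ w₀ L≤t = refl

    head-move : ∀ u → Move G (fromMaybe (robber 0) (head (visited u))) (robber u)
    head-move zero    = inj₁ refl
    head-move (suc u) = robberAt-move rs u

    guards-move-early : ∀ {t} → suc t ≤ L →
                        Pointwise (Move G) (guards (visited t)) (guards (visited (suc t)))
    guards-move-early {t} t<L j
      rewrite guards-visited t j | guards-visited (suc t) j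
            | drop-all L (visited t) (subst (_≤ L) (sym (length-trail rs t)) (<⇒≤ t<L))
            | drop-all L (visited (suc t)) (subst (_≤ L) (sym (length-trail rs (suc t))) t<L)
      = walkAt-move w₀ t

    guards-move-late : ∀ {t} → L ≤ t →
                       Pointwise (Move G) (guards (visited t)) (guards (visited (suc t)))
    guards-move-late {t} L≤t j
      rewrite guards-late L≤t j | guards-late (m≤n⇒m≤1+n L≤t) j | +-∸-assoc 1 L≤t
      = guard-move {R = Move G} (inj₁ refl) (visited (t ∸ L)) (robber 0) (toℕ j) (head-move (t ∸ L))

    guards-move : ∀ t → Pointwise (Move G) (guards (visited t)) (guards (visited (suc t)))
    guards-move t with suc t ≤? L
    ... | yes t<L = guards-move-early t<L
    ... | no  t≮L = guards-move-late (s≤s⁻¹ (≰⇒> t≮L))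

    plan-move : ∀ t → Pointwise (Move G) (plan (visited t)) (plan (visited (suc t)))
    plan-move t = ++⁺ (Move G) (Game.replayCops-move S (robber t) (visited t)) (guards-move t)

    copsAt-guarded : ∀ t i → copsAt planned rs t i ≡ plan (visited t) i
    copsAt-guarded = copsAt-planned rs plan-move

    simulated-cops : ∀ t i → copsAt S replayRobber t i ≡ copsAt planned rs t (i ↑ˡ d)
    simulated-cops t i = begin
      copsAt S replayRobber t i                ≡⟨ cong (λ cops → cops i) (copsAt-replayRobber S t) ⟩
      Game.replayCops S (visited t) i          ≡⟨ lookup-++ˡ (Game.replayCops S (visited t)) _ i ⟨
      plan (visited t) (i ↑ˡ d)                ≡⟨ copsAt-guarded t (i ↑ˡ d) ⟨
      copsAt planned rs t (i ↑ˡ d)             ∎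
      where open ≡-Reasoning

    caught-simulated : ∀ t → CaughtIn S replayRobber t → CaughtIn planned rs t
    caught-simulated = CaughtIn-subteam (_↑ˡ d) simulated-cops (robberAt-replayRobber S)

    visited-damaged : ∀ {T v} → EvadesUntil rs T → v ∈ visited T → Damaged S replayRobber v
    visited-damaged {T} evades v∈ with ∈-trail rs T v∈
    ... | s , s<T , refl =
      s , robberAt-replayRobber S s ,
      (λ s′ s′≤s caught → evades s′ (≤-trans s′≤s (<⇒≤ s<T)) (caught-simulated s′ caught)) ,
      (λ i on-robber → evades (suc s) s<T (caught-simulated (suc s) (inj₁ (i , on-robber))))

    #visited≤d : ∀ {T} → EvadesUntil rs T → #distinct (visited T) ≤ d
    #visited≤d {T} evades = damage≤d replayRobber (distinct (visited T)) (distinct-unique (visited T))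
                              (tabulateAll (visited-damaged evades ∘ ∈-distinct⁻ (visited T)))

    -- At round t every vertex visited before round t ∸ L has its own guard.
    no-revisit : ∀ {t} → L ≤ t → EvadesUntil rs t → robber t ∉ visited (t ∸ L)
    no-revisit {t} L≤t evades revisit with guard-covers (visited (t ∸ L)) (robber 0) revisit
    ... | j , j<#visited , guard≡robber =
      evades t ≤-refl (caughtIn-onRobber rs t (k ↑ʳ jᶠ) guard-on-robber)
      where
        j<d : j < d
        j<d = <-≤-trans j<#visited (#visited≤d (evadesUntil-mono rs (m∸n≤m t L) evades))

        jᶠ : Fin d
        jᶠ = fromℕ< j<d

        open ≡-Reasoning
        guard-on-robber : copsAt planned rs t (k ↑ʳ jᶠ) ≡ robber t
        guard-on-robber = begin
          copsAt planned rs t (k ↑ʳ jᶠ)                ≡⟨ copsAt-guarded t (k ↑ʳ jᶠ) ⟩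
          plan (visited t) (k ↑ʳ jᶠ)                   ≡⟨ lookup-++ʳ (Game.replayCops S (visited t)) _ jᶠ ⟩
          guards (visited t) jᶠ                        ≡⟨ guards-late L≤t jᶠ ⟩
          guard (visited (t ∸ L)) (robber 0) (toℕ jᶠ)  ≡⟨ cong (guard (visited (t ∸ L)) (robber 0)) (toℕ-fromℕ< j<d) ⟩
          guard (visited (t ∸ L)) (robber 0) j         ≡⟨ guard≡robber ⟩
          robber t                                     ∎

    #visited-grows : ∀ {t} → L ≤ t → EvadesUntil rs t →
                     #distinct (visited (t ∸ L)) < #distinct (visited (suc t))
    #visited-grows {t} L≤t evades = begin-strict
      #distinct (visited (t ∸ L))                  ≡⟨ cong #distinct (drop-trail rs (s≤s L≤t)) ⟨
      #distinct (drop (suc L) vs)                  <⟨ #distinct-++-< (take (suc L) vs) _ (here refl) new ⟩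
      #distinct (take (suc L) vs ++ drop (suc L) vs) ≡⟨ cong #distinct (take++drop≡id (suc L) vs) ⟩
      #distinct vs                                 ∎
      where
        open ≤-Reasoning
        vs : List (Fin n)
        vs = visited (suc t)
        new : robber t ∉ drop (suc L) vs
        new = subst (robber t ∉_) (sym (drop-trail rs (s≤s L≤t))) (no-revisit L≤t evades)

    #visited-linear : ∀ m → EvadesUntil rs (m * suc L) → m ≤ #distinct (visited (m * suc L))
    #visited-linear zero    _      = z≤n
    #visited-linear (suc m) evades = ≤-<-trans
      (#visited-linear m (evadesUntil-mono rs (m≤n+m _ (suc L)) evades))
      (subst (λ u → #distinct (visited u) < #distinct (visited (suc m * suc L)))
             (m+n∸m≡n L (m * suc L))
             (#visited-grows (m≤m+n L _) (evadesUntil-mono rs (n≤1+n _) evades)))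

    evasion-impossible : ¬ EvadesUntil rs (suc d * suc L)
    evasion-impossible evades = n≮n d (≤-trans (#visited-linear (suc d) evades) (#visited≤d evades))

  copsWin : CopsWin G (k + d)
  copsWin = planned , λ rs →
    [ id , flip contradiction (evasion-impossible rs) ]′
      (Game.capture-or-evasion planned rs (suc d * suc (L rs)))

DmgAtMost⇒CopsWin : ∀ {n} (G : SimpleGraph n) → Connected G → Fin n →
                   ∀ {k d} → DmgAtMost G k d → CopsWin G (k + d)
DmgAtMost⇒CopsWin G conn x₀ (S , damage≤d) = Guarded.copsWin G conn x₀ S damage≤d

proposition2p2 : (n : ℕ) (G : SimpleGraph n) → Connected G →
                 (c t : ℕ) → IsCopNumber G c → IsDmgThrottle G t → c ≤ t
proposition2p2 n G conn c _ (_ , fewer-lose) ((k , d , 1≤k , k≤n , (k-damage≤d , _) , refl) , _) =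
  ≮⇒≥ λ k+d<c →
    fewer-lose (k + d) k+d<c (DmgAtMost⇒CopsWin G conn (fromℕ< (≤-trans 1≤k k≤n)) k-damage≤d)
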